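{- For all formulas $\varphi,\psi$, the formula $\neg(\varphi\rightsquigarrow\psi)\leftrightarrow\neg(\varphi\to\psi)$ belongs to $\mathsf{IELE}$.
   Context: Formulas: $\varphi::=p\mid\top\mid\bot\mid\varphi\wedge\varphi\mid\varphi\vee\varphi\mid\varphi\to\varphi\mid\varphi\rightsquigarrow\varphi$; $\neg\varphi:=\varphi\to\bot$. $\mathsf{iA}$ is the smallest set of formulas containing all theorems of intuitionistic propositional logic and all instances of $((\varphi\rightsquigarrow\psi)\wedge(\varphi\rightsquigarrow\chi))\to(\varphi\rightsquigarrow(\psi\wedge\chi))$, $((\varphi\rightsquigarrow\chi)\wedge(\psi\rightsquigarrow\chi))\to((\varphi\vee\psi)\rightsquigarrow\chi)$, $((\varphi\rightsquigarrow\psi)\wedge(\psi\rightsquigarrow\chi))\to(\varphi\rightsquigarrow\chi)$, closed under modus ponens, the rule from $\varphi\to\psi$ infer $\varphi\rightsquigarrow\psi$, and uniform substitution. $\mathsf{IELE}$ is the smallest such set that additionally contains all instances of $(\varphi\to\psi)\to(\varphi\rightsquigarrow\psi)$ and of $(\varphi\rightsquigarrow\psi)\to\neg\neg(\varphi\to\psi)$. -}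

module Defs where

open import Data.Nat using (ℕ)

-- Formulas of the language with strict implication ⥽ (written _⇝_)
infixr 6 _∧_
infixr 5 _∨_
infixr 4 _⇒_ _⇝_ _⇔_

data Formula : Set where
  var : ℕ → Formula
  ⊤   : Formula
  ⊥   : Formula
  _∧_ : Formula → Formula → Formula
  _∨_ : Formula → Formula → Formula
  _⇒_ : Formula → Formula → Formula
  _⇝_ : Formula → Formula → Formula

¬_ : Formula → Formula
¬ φ = φ ⇒ ⊥

_⇔_ : Formula → Formula → Formula
φ ⇔ ψ = (φ ⇒ ψ) ∧ (ψ ⇒ φ)

Subst : Set
Subst = ℕ → Formula

_[_] : Formula → Subst → Formula
var p   [ σ ] = σ p
⊤       [ σ ] = ⊤
⊥       [ σ ] = ⊥
(φ ∧ ψ) [ σ ] = (φ [ σ ]) ∧ (ψ [ σ ])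
(φ ∨ ψ) [ σ ] = (φ [ σ ]) ∨ (ψ [ σ ])
(φ ⇒ ψ) [ σ ] = (φ [ σ ]) ⇒ (ψ [ σ ])
(φ ⇝ ψ) [ σ ] = (φ [ σ ]) ⇝ (ψ [ σ ])

-- Theorems of intuitionistic propositional logic in the full language
-- (⇝-formulas treated as atoms): a standard Hilbert-style calculus.
data IPC : Formula → Set where
  ax-K     : ∀ {φ ψ} → IPC (φ ⇒ ψ ⇒ φ)
  ax-S     : ∀ {φ ψ χ} → IPC ((φ ⇒ ψ ⇒ χ) ⇒ (φ ⇒ ψ) ⇒ φ ⇒ χ)
  ax-∧E₁   : ∀ {φ ψ} → IPC (φ ∧ ψ ⇒ φ)
  ax-∧E₂   : ∀ {φ ψ} → IPC (φ ∧ ψ ⇒ ψ)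
  ax-∧I    : ∀ {φ ψ} → IPC (φ ⇒ ψ ⇒ φ ∧ ψ)
  ax-∨I₁   : ∀ {φ ψ} → IPC (φ ⇒ φ ∨ ψ)
  ax-∨I₂   : ∀ {φ ψ} → IPC (ψ ⇒ φ ∨ ψ)
  ax-∨E    : ∀ {φ ψ χ} → IPC ((φ ⇒ χ) ⇒ (ψ ⇒ χ) ⇒ φ ∨ ψ ⇒ χ)
  ax-⊤     : IPC ⊤
  ax-⊥     : ∀ {φ} → IPC (⊥ ⇒ φ)
  ipc-mp   : ∀ {φ ψ} → IPC (φ ⇒ ψ) → IPC φ → IPC ψ

-- IELE: the smallest set containing IPC theorems, the iA axioms and the
-- two IELE axioms, closed under MP, the rule φ→ψ / φ⇝ψ, and uniform substitution.
data IELE : Formula → Set where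
  ipc      : ∀ {φ} → IPC φ → IELE φ
  ax-Ki    : ∀ {φ ψ χ} → IELE (((φ ⇝ ψ) ∧ (φ ⇝ χ)) ⇒ (φ ⇝ (ψ ∧ χ)))
  ax-Di    : ∀ {φ ψ χ} → IELE (((φ ⇝ χ) ∧ (ψ ⇝ χ)) ⇒ ((φ ∨ ψ) ⇝ χ))
  ax-I     : ∀ {φ ψ χ} → IELE (((φ ⇝ ψ) ∧ (ψ ⇝ χ)) ⇒ (φ ⇝ χ))
  ax-CoE   : ∀ {φ ψ} → IELE ((φ ⇒ ψ) ⇒ (φ ⇝ ψ))
  ax-E     : ∀ {φ ψ} → IELE ((φ ⇝ ψ) ⇒ ¬ ¬ (φ ⇒ ψ))
  mp       : ∀ {φ ψ} → IELE (φ ⇒ ψ) → IELE φ → IELE ψ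
  nec      : ∀ {φ ψ} → IELE (φ ⇒ ψ) → IELE (φ ⇝ ψ)
  usubst   : ∀ {φ} (σ : Subst) → IELE φ → IELE (φ [ σ ])

{-# OPTIONS --safe #-}
module Submission where

open import Defs

-- ¬(φ ⇝ ψ) → ¬(φ → ψ) is the contrapositive of the axiom (φ → ψ) → (φ ⇝ ψ);
-- conversely, ¬(φ → ψ) refutes the ¬¬(φ → ψ) that φ ⇝ ψ implies.

private
  variable
    A B C : Formula

infixl 9 _·_
_·_ : IPC (A ⇒ B) → IPC A → IPC B
_·_ = ipc-mp

compose : IPC ((B ⇒ C) ⇒ (A ⇒ B) ⇒ A ⇒ C)
compose = ax-S · (ax-K · ax-S) · ax-K

flip : IPC ((A ⇒ B ⇒ C) ⇒ B ⇒ A ⇒ C)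
flip = ax-S · (compose · compose · ax-S) · (ax-K · ax-K)

IELE-flip : IELE (A ⇒ B ⇒ C) → IELE (B ⇒ A ⇒ C)
IELE-flip = mp (ipc flip)

IELE-contraposition : IELE (A ⇒ B) → IELE (¬ B ⇒ ¬ A)
IELE-contraposition = mp (ipc (flip · compose))

IELE-⇔-intro : IELE (A ⇒ B) → IELE (B ⇒ A) → IELE (A ⇔ B)
IELE-⇔-intro A⇒B B⇒A = mp (mp (ipc ax-∧I) A⇒B) B⇒A

proposition2p9 : ∀ (φ ψ : Formula) → IELE ((¬ (φ ⇝ ψ)) ⇔ (¬ (φ ⇒ ψ)))
proposition2p9 φ ψ = IELE-⇔-intro (IELE-contraposition ax-CoE) (IELE-flip ax-E)
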